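{- Let $k\ge3$ be odd, let $H$ be a Kimura Hadamard matrix of order $n=8k+4$ and let $(R,S)\in\mathrm{Aut}(H)$ with both $R$ and $S$ diagonal matrices. Then $(R,S)\in\{(I_n,I_n),(-I_n,-I_n)\}$.
   Context: $D_{2k}=\langle x,y\mid x^k=1,\ y^2=1,\ y^{ -1}xy=x^{ -1}\rangle$, with elements listed in the order $x^0,\dots,x^{k-1},y,xy,\dots,x^{k-1}y$, which indexes rows and columns of $2k\times2k$ matrices. $\rho(g)=[\delta_{ug,v}]_{u,v}$ is the right regular matrix representation, extended linearly to $\mathbb{Z}D_{2k}$; for $w\in\mathbb{Z}D_{2k}$ with coefficients in $\{0,1\}$ its associated $\pm1$-matrix is $2\rho(w)-J_{2k}$. A Kimura Hadamard matrix of order $8k+4$ is a matrix \[ H=\begin{bmatrix} 1& 1 & 1 & 1 & \mathbf{1} & \mathbf{1} & \mathbf{1} & \mathbf{1}\\ 1& 1 & -1 & -1 & \mathbf{1} & \mathbf{1} & -\mathbf{1} & -\mathbf{1}\\ 1& -1 & 1 & -1 & \mathbf{1} & -\mathbf{1} & \mathbf{1} & -\mathbf{1}\\ 1& -1 & -1 & 1 & -\mathbf{1} & \mathbf{1} & \mathbf{1} & -\mathbf{1}\\ \mathbf{1}^\intercal & \mathbf{1}^\intercal & \mathbf{1}^\intercal & -\mathbf{1}^\intercal & A & B& C & D\\ \mathbf{1}^\intercal & \mathbf{1}^\intercal& -\mathbf{1}^\intercal & \mathbf{1}^\intercal & -B & A & D & -C\\ \mathbf{1}^\intercal & -\mathbf{1}^\intercal&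 \mathbf{1}^\intercal & \mathbf{1}^\intercal & -C & -D & A & B\\ \mathbf{1}^\intercal & -\mathbf{1}^\intercal& -\mathbf{1}^\intercal & -\mathbf{1}^\intercal & D & -C & B & -A \end{bmatrix} \] ($\mathbf 1$ the all-ones row vector of length $2k$) with $HH^\intercal=(8k+4)I_{8k+4}$, where $A,B,C,D$ are the $\pm1$-matrices associated to some $a,b,c,d\in\mathbb{Z}D_{2k}$ with coefficients in $\{0,1\}$. $\mathrm{Aut}(H)=\{(R,S): R,S\ \text{are}\ n\times n\ \text{signed permutation matrices},\ RHS^\intercal=H\}$. -}

module Defs where

open import Data.Bool using (Bool; true; false; if_then_else_; _xor_)
import Data.Bool.Properties as BoolP
open import Data.Nat as ℕ using (ℕ; NonZero; _∸_)
open import Data.Nat.DivMod using (_mod_)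
open import Data.Fin as Fin using (Fin; toℕ)
import Data.Fin.Properties as FinP
open import Data.Integer as ℤ using (ℤ; +_; -_)
open import Data.List using (List; []; _∷_; map; _++_; concatMap; allFin; foldr)
open import Data.Vec using (Vec; []; _∷_; lookup)
open import Data.Product using (_×_; _,_; Σ; ∃)
import Data.Product.Properties as ProdP
open import Data.Sum using (_⊎_; inj₁; inj₂)
import Data.Sum.Properties as SumP
open import Relation.Binary.PropositionalEquality using (_≡_; _≢_)
open import Relation.Binary.Definitions using (DecidableEquality)
open import Relation.Nullary.Decidable using (⌊_⌋)

sumL : {A : Set} → List A → (A → ℤ) → ℤ
sumL xs f = foldr (λ x acc → f x ℤ.+ acc) (+ 0) xs

-- The dihedral group D_{2k}.  The pair (e , i) represents x^i y^e
-- (e = false : x^i,  e = true : x^i y).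

D : ℕ → Set
D k = Bool × Fin k

enumD : (k : ℕ) → List (D k)
enumD k = map (false ,_) (allFin k) ++ map (true ,_) (allFin k)

decD : (k : ℕ) → DecidableEquality (D k)
decD k = ProdP.≡-dec BoolP._≟_ FinP._≟_

-- (x^a y^e)(x^b y^f) = x^(a + (-1)^e b) y^(e+f)
mulD : (k : ℕ) .{{_ : NonZero k}} → D k → D k → D k
mulD k (e , a) (f , b) =
  (e xor f , ((toℕ a ℕ.+ (if e then k ∸ toℕ b else toℕ b)) mod k))

-- coefficient of an element of ZD_{2k} with coefficients in {0,1}
coef : Bool → ℤ
coef true  = + 1
coef false = + 0

-- rho(w)_{u,v} = sum_g w_g [u g = v]  (right regular representation,
-- extended linearly)
rho : (k : ℕ) .{{_ : NonZero k}} → (D k → Bool) → D k → D k → ℤ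
rho k w u v =
  sumL (enumD k) (λ g → coef (w g) ℤ.* coef ⌊ decD k (mulD k u g) v ⌋)

pmMat : (k : ℕ) .{{_ : NonZero k}} → (D k → Bool) → D k → D k → ℤ
pmMat k w u v = (+ 2) ℤ.* rho k w u v ℤ.- (+ 1)

-- Index set of the Kimura matrix: 4 single rows/columns followed by
-- 4 blocks of size 2k (total 8k+4).

Idx : ℕ → Set
Idx k = Fin 4 ⊎ (Fin 4 × D k)

enumIdx : (k : ℕ) → List (Idx k)
enumIdx k = map inj₁ (allFin 4) ++
            concatMap (λ i → map (λ g → inj₂ (i , g)) (enumD k)) (allFin 4)

decIdx : (k : ℕ) → DecidableEquality (Idx k)
decIdx k = SumP.≡-dec FinP._≟_ (ProdP.≡-dec FinP._≟_ (decD k))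

Mat : ℕ → Set
Mat k = Idx k → Idx k → ℤ

_·_ : {k : ℕ} → Mat k → Mat k → Mat k
_·_ {k} M N i j = sumL (enumIdx k) (λ l → M i l ℤ.* N l j)

transpose : {k : ℕ} → Mat k → Mat k
transpose M i j = M j i

idM : (k : ℕ) → Mat k
idM k i j = if ⌊ decIdx k i j ⌋ then + 1 else + 0

scal : {k : ℕ} → ℤ → Mat k → Mat k
scal c M i j = c ℤ.* M i j

negM : {k : ℕ} → Mat k → Mat k
negM M i j = - M i j

private
  p m : ℤ
  p = + 1
  m = - (+ 1)

signTL : Vec (Vec ℤ 4) 4
signTL = (p ∷ p ∷ p ∷ p ∷ []) ∷ (p ∷ p ∷ m ∷ m ∷ []) ∷
         (p ∷ m ∷ p ∷ m ∷ []) ∷ (p ∷ m ∷ m ∷ p ∷ []) ∷ []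

-- top-right: signs of the all-ones row vectors
signTR : Vec (Vec ℤ 4) 4
signTR = (p ∷ p ∷ p ∷ p ∷ []) ∷ (p ∷ p ∷ m ∷ m ∷ []) ∷
         (p ∷ m ∷ p ∷ m ∷ []) ∷ (m ∷ p ∷ p ∷ m ∷ []) ∷ []

-- bottom-left: signs of the all-ones column vectors (block row, column)
signBL : Vec (Vec ℤ 4) 4
signBL = (p ∷ p ∷ p ∷ m ∷ []) ∷ (p ∷ p ∷ m ∷ p ∷ []) ∷
         (p ∷ m ∷ p ∷ p ∷ []) ∷ (p ∷ m ∷ m ∷ m ∷ []) ∷ []

-- bottom-right: sign and which of A(0),B(1),C(2),D(3)
signBR : Vec (Vec ℤ 4) 4
signBR = (p ∷ p ∷ p ∷ p ∷ []) ∷ (m ∷ p ∷ p ∷ m ∷ []) ∷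
         (m ∷ m ∷ p ∷ p ∷ []) ∷ (p ∷ m ∷ p ∷ m ∷ []) ∷ []

selBR : Vec (Vec (Fin 4) 4) 4
selBR = (Fin.# 0 ∷ Fin.# 1 ∷ Fin.# 2 ∷ Fin.# 3 ∷ []) ∷
        (Fin.# 1 ∷ Fin.# 0 ∷ Fin.# 3 ∷ Fin.# 2 ∷ []) ∷
        (Fin.# 2 ∷ Fin.# 3 ∷ Fin.# 0 ∷ Fin.# 1 ∷ []) ∷
        (Fin.# 3 ∷ Fin.# 2 ∷ Fin.# 1 ∷ Fin.# 0 ∷ []) ∷ []

choose4 : {X : Set} → X → X → X → X → Fin 4 → X
choose4 a b c d i = lookup (a ∷ b ∷ c ∷ d ∷ []) i

kimura : (k : ℕ) .{{_ : NonZero k}} → (a b c d : D k → Bool) → Mat k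
kimura k a b c d (inj₁ i) (inj₁ j) = lookup (lookup signTL i) j
kimura k a b c d (inj₁ i) (inj₂ (j , v)) = lookup (lookup signTR i) j
kimura k a b c d (inj₂ (i , u)) (inj₁ j) = lookup (lookup signBL i) j
kimura k a b c d (inj₂ (i , u)) (inj₂ (j , v)) =
  lookup (lookup signBR i) j ℤ.*
  pmMat k (choose4 a b c d (lookup (lookup selBR i) j)) u v

IsHadamardKimura : (k : ℕ) .{{_ : NonZero k}} → (a b c d : D k → Bool) → Set
IsHadamardKimura k a b c d =
  ∀ i j → (H · transpose H) i j ≡ scal (+ (8 ℕ.* k ℕ.+ 4)) (idM k) i j
  where H = kimura k a b c d

IsSignedPerm : {k : ℕ} → Mat k → Set
IsSignedPerm {k} M =
  (∀ i j → M i j ≡ + 0 ⊎ (M i j ≡ + 1 ⊎ M i j ≡ - (+ 1))) ×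
  (∀ i → Σ (Idx k) λ j → M i j ≢ + 0 × (∀ j' → M i j' ≢ + 0 → j' ≡ j)) ×
  (∀ j → Σ (Idx k) λ i → M i j ≢ + 0 × (∀ i' → M i' j ≢ + 0 → i' ≡ i))

IsDiagonal : {k : ℕ} → Mat k → Set
IsDiagonal M = ∀ i j → i ≢ j → M i j ≡ + 0

InAut : {k : ℕ} → Mat k → Mat k → Mat k → Set
InAut H R S = IsSignedPerm R × IsSignedPerm S ×
              (∀ i j → ((R · H) · transpose S) i j ≡ H i j)

_≐_ : {k : ℕ} → Mat k → Mat k → Set
M ≐ N = ∀ i j → M i j ≡ N i j

{-# OPTIONS --safe #-}
-- Diagonal R and S act on H entrywise: (R H Sᵀ)ᵢⱼ = rᵢ hᵢⱼ sⱼ.  Every entry of a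
-- Kimura matrix is ±1, so R H Sᵀ = H forces rᵢ sⱼ = 1 for all i and j, and hence
-- all the diagonal entries of R and S are one and the same sign.
module Submission where

open import Defs
open import Data.Nat using (ℕ; NonZero; _≤_; _%_)
import Data.Nat as ℕ
import Data.Nat.Properties as ℕ
open import Data.Bool using (Bool)
open import Data.Empty using (⊥-elim)
open import Data.Fin using (zero)
open import Data.Fin.Properties using (all?)
open import Data.Integer as ℤ using (ℤ; +_; -_; _*_; 0ℤ; 1ℤ; -1ℤ)
import Data.Integer.Properties as ℤ
open import Data.Integer.Tactic.RingSolver using (solve-∀)
open import Data.List using (List; []; _∷_)
open import Data.Product using (_×_; _,_; proj₁; proj₂)
open import Data.Sum using (_⊎_; inj₁; inj₂)
open import Data.Vec using (Vec; lookup)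
open import Relation.Binary.Definitions using (DecidableEquality)
open import Relation.Binary.PropositionalEquality
  using (_≡_; _≢_; refl; sym; trans; cong; module ≡-Reasoning)
open import Relation.Nullary using (Dec; yes; no; ¬?)
open import Relation.Nullary.Decidable using (from-yes)

open ≡-Reasoning

IsSign : ℤ → Set
IsSign r = r ≡ 1ℤ ⊎ r ≡ -1ℤ

IsSignOrZero : ℤ → Set
IsSignOrZero r = r ≡ 0ℤ ⊎ IsSign r

i*j≡i⇒j≡1 : ∀ {i j} → i ≢ 0ℤ → i * j ≡ i → j ≡ 1ℤ
i*j≡i⇒j≡1 {i} {j} i≢0 eq =
  ℤ.*-cancelˡ-≡ i j 1ℤ {{ℤ.≢-nonZero i≢0}} (trans eq (sym (ℤ.*-identityʳ i)))

i*j≢0 : ∀ {i j} → i ≢ 0ℤ → j ≢ 0ℤ → i * j ≢ 0ℤ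
i*j≢0 {i} i≢0 j≢0 eq with ℤ.i*j≡0⇒i≡0∨j≡0 i eq
... | inj₁ i≡0 = i≢0 i≡0
... | inj₂ j≡0 = j≢0 j≡0

2*i-1≢0 : ∀ i → + 2 * i ℤ.- 1ℤ ≢ 0ℤ
2*i-1≢0 i eq
  with ℕ.m*n≡1⇒m≡1 2 ℤ.∣ i ∣
         (trans (sym (ℤ.abs-* (+ 2) i)) (cong ℤ.∣_∣ (ℤ.i-j≡0⇒i≡j (+ 2 * i) 1ℤ eq)))
... | ()

-n≢1 : ∀ n → - (+ n) ≢ 1ℤ
-n≢1 0 ()
-n≢1 (ℕ.suc n) ()

r*s*n≡1⇒r≡s≡±1 : ∀ {r s} n → IsSignOrZero r → IsSignOrZero s →
                 r * s * + n ≡ 1ℤ → r ≡ s × IsSign r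
r*s*n≡1⇒r≡s≡±1 n (inj₁ refl) _ ()
r*s*n≡1⇒r≡s≡±1 n (inj₂ (inj₁ refl)) (inj₁ refl) ()
r*s*n≡1⇒r≡s≡±1 n (inj₂ (inj₂ refl)) (inj₁ refl) ()
r*s*n≡1⇒r≡s≡±1 n (inj₂ (inj₁ refl)) (inj₂ (inj₁ refl)) _ = refl , inj₁ refl
r*s*n≡1⇒r≡s≡±1 n (inj₂ (inj₂ refl)) (inj₂ (inj₂ refl)) _ = refl , inj₂ refl
r*s*n≡1⇒r≡s≡±1 n (inj₂ (inj₁ refl)) (inj₂ (inj₂ refl)) eq =
  ⊥-elim (-n≢1 n (trans (sym (ℤ.-1*i≡-i (+ n))) eq))
r*s*n≡1⇒r≡s≡±1 n (inj₂ (inj₂ refl)) (inj₂ (inj₁ refl)) eq =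
  ⊥-elim (-n≢1 n (trans (sym (ℤ.-1*i≡-i (+ n))) eq))

multiplicity : {A : Set} → DecidableEquality A → A → List A → ℕ
multiplicity _≟_ x [] = 0
multiplicity _≟_ x (y ∷ ys) with y ≟ x
... | yes _ = ℕ.suc (multiplicity _≟_ x ys)
... | no _ = multiplicity _≟_ x ys

sumL-supported : {A : Set} (_≟_ : DecidableEquality A) (f : A → ℤ) (x : A) →
                 (∀ y → y ≢ x → f y ≡ 0ℤ) →
                 ∀ ys → sumL ys f ≡ f x * + multiplicity _≟_ x ys
sumL-supported _≟_ f x f≡0 [] = sym (ℤ.*-zeroʳ (f x))
sumL-supported _≟_ f x f≡0 (y ∷ ys) with y ≟ x
... | yes refl = begin
  f x ℤ.+ sumL ys f       ≡⟨ cong (ℤ._+_ (f x)) (sumL-supported _≟_ f x f≡0 ys) ⟩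
  f x ℤ.+ f x * + m       ≡⟨ cong (ℤ._+ f x * + m) (sym (ℤ.*-identityʳ (f x))) ⟩
  f x * 1ℤ ℤ.+ f x * + m  ≡⟨ sym (ℤ.*-distribˡ-+ (f x) 1ℤ (+ m)) ⟩
  f x * + ℕ.suc m         ∎
  where m = multiplicity _≟_ x ys
... | no y≢x = begin
  f y ℤ.+ sumL ys f  ≡⟨ cong (ℤ._+ sumL ys f) (f≡0 y y≢x) ⟩
  0ℤ ℤ.+ sumL ys f   ≡⟨ ℤ.+-identityˡ (sumL ys f) ⟩
  sumL ys f          ≡⟨ sumL-supported _≟_ f x f≡0 ys ⟩
  _                  ∎

module _ {k : ℕ} where

  idxMultiplicity : Idx k → ℕ
  idxMultiplicity i = multiplicity (decIdx k) i (enumIdx k)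

  ·-diagonalˡ : (R M : Mat k) → IsDiagonal R →
                ∀ i j → (R · M) i j ≡ R i i * M i j * + idxMultiplicity i
  ·-diagonalˡ R M R-diag i j =
    sumL-supported (decIdx k) (λ l → R i l * M l j) i
      (λ l l≢i → cong (_* M l j) (R-diag i l (λ i≡l → l≢i (sym i≡l))))
      (enumIdx k)

  ·-transpose-diagonalʳ : (M S : Mat k) → IsDiagonal S →
                          ∀ i j → (M · transpose S) i j ≡ M i j * S j j * + idxMultiplicity j
  ·-transpose-diagonalʳ M S S-diag i j =
    sumL-supported (decIdx k) (λ l → M i l * S j l) j
      (λ l l≢j → trans (cong (M i l *_) (S-diag j l (λ j≡l → l≢j (sym j≡l))))
                       (ℤ.*-zeroʳ (M i l)))
      (enumIdx k)

  diagonal-conjugate : (R M S : Mat k) → IsDiagonal R → IsDiagonal S → ∀ i j →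
    ((R · M) · transpose S) i j ≡
    M i j * (R i i * S j j * + (idxMultiplicity i ℕ.* idxMultiplicity j))
  diagonal-conjugate R M S R-diag S-diag i j = begin
    ((R · M) · transpose S) i j      ≡⟨ ·-transpose-diagonalʳ (R · M) S S-diag i j ⟩
    (R · M) i j * S j j * + mⱼ       ≡⟨ cong (λ x → x * S j j * + mⱼ) (·-diagonalˡ R M R-diag i j) ⟩
    R i i * M i j * + mᵢ * S j j * + mⱼ
                                     ≡⟨ rearrange (R i i) (M i j) (S j j) (+ mᵢ) (+ mⱼ) ⟩
    M i j * (R i i * S j j * (+ mᵢ * + mⱼ))
                                     ≡⟨ cong (λ x → M i j * (R i i * S j j * x)) (sym (ℤ.pos-* mᵢ mⱼ)) ⟩
    M i j * (R i i * S j j * + (mᵢ ℕ.* mⱼ)) ∎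
    where
    mᵢ = idxMultiplicity i
    mⱼ = idxMultiplicity j
    rearrange : ∀ r h s m n → r * h * m * s * n ≡ h * (r * s * (m * n))
    rearrange = solve-∀

  diagonal⇒≐scal : (M : Mat k) (v : ℤ) → IsDiagonal M → (∀ i → M i i ≡ v) →
                   M ≐ scal v (idM k)
  diagonal⇒≐scal M v M-diag Mᵢᵢ≡v i j with decIdx k i j
  ... | yes refl = trans (Mᵢᵢ≡v i) (sym (ℤ.*-identityʳ v))
  ... | no i≢j = trans (M-diag i j i≢j) (sym (ℤ.*-zeroʳ v))

  scal±1⇒±id : (M N : Mat k) {v : ℤ} → IsSign v →
    M ≐ scal v (idM k) → N ≐ scal v (idM k) →
    ((M ≐ idM k) × (N ≐ idM k)) ⊎ ((M ≐ negM (idM k)) × (N ≐ negM (idM k)))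
  scal±1⇒±id M N (inj₁ refl) M≐I N≐I =
    inj₁ ( (λ i j → trans (M≐I i j) (ℤ.*-identityˡ (idM k i j)))
         , (λ i j → trans (N≐I i j) (ℤ.*-identityˡ (idM k i j))))
  scal±1⇒±id M N (inj₂ refl) M≐-I N≐-I =
    inj₂ ( (λ i j → trans (M≐-I i j) (ℤ.-1*i≡-i (idM k i j)))
         , (λ i j → trans (N≐-I i j) (ℤ.-1*i≡-i (idM k i j))))

  diagonalAut⇒±id : (H R S : Mat k) → (∀ i j → H i j ≢ 0ℤ) → InAut H R S →
    IsDiagonal R → IsDiagonal S →
    ((R ≐ idM k) × (S ≐ idM k)) ⊎ ((R ≐ negM (idM k)) × (S ≐ negM (idM k)))
  diagonalAut⇒±id H R S H≢0 ((R-entries , _) , (S-entries , _) , RHSᵀ≡H) R-diag S-diag =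
    scal±1⇒±id R S (proj₂ (Rᵢᵢ≡Sⱼⱼ≡±1 o o))
      (diagonal⇒≐scal R (R o o) R-diag
        (λ i → trans (proj₁ (Rᵢᵢ≡Sⱼⱼ≡±1 i o)) (sym (proj₁ (Rᵢᵢ≡Sⱼⱼ≡±1 o o)))))
      (diagonal⇒≐scal S (R o o) S-diag (λ j → sym (proj₁ (Rᵢᵢ≡Sⱼⱼ≡±1 o j))))
    where
    -- Each index enters the sums of _·_ with its multiplicity in enumIdx, which we
    -- never need to compute: r s m = 1 with r, s ∈ {0, ±1} and m : ℕ forces r = s = ±1.
    Rᵢᵢ≡Sⱼⱼ≡±1 : ∀ i j → R i i ≡ S j j × IsSign (R i i)
    Rᵢᵢ≡Sⱼⱼ≡±1 i j =
      r*s*n≡1⇒r≡s≡±1 _ (R-entries i i) (S-entries j j)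
        (i*j≡i⇒j≡1 (H≢0 i j)
          (trans (sym (diagonal-conjugate R H S R-diag S-diag i j)) (RHSᵀ≡H i j)))
    o : Idx k
    o = inj₁ zero

Entries≢0 : Vec (Vec ℤ 4) 4 → Set
Entries≢0 M = ∀ i j → lookup (lookup M i) j ≢ 0ℤ

entries≢0? : (M : Vec (Vec ℤ 4) 4) → Dec (Entries≢0 M)
entries≢0? M = all? λ i → all? λ j → ¬? (lookup (lookup M i) j ℤ.≟ 0ℤ)

kimura≢0 : (k : ℕ) .{{_ : NonZero k}} (a b c d : D k → Bool) →
           ∀ i j → kimura k a b c d i j ≢ 0ℤ
kimura≢0 k a b c d (inj₁ i) (inj₁ j) = from-yes (entries≢0? signTL) i j
kimura≢0 k a b c d (inj₁ i) (inj₂ (j , _)) = from-yes (entries≢0? signTR) i j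
kimura≢0 k a b c d (inj₂ (i , _)) (inj₁ j) = from-yes (entries≢0? signBL) i j
kimura≢0 k a b c d (inj₂ (i , u)) (inj₂ (j , v)) =
  i*j≢0 (from-yes (entries≢0? signBR) i j)
        (2*i-1≢0 (rho k (choose4 a b c d (lookup (lookup selBR i) j)) u v))

-- Only the nonvanishing of the entries of H is needed: neither the parity and size
-- of k nor the Hadamard property enters.
proposition3p10 : (k : ℕ) .{{_ : NonZero k}} → 3 ≤ k → k % 2 ≡ 1 →
    (a b c d : D k → Bool) → IsHadamardKimura k a b c d →
    (R S : Mat k) → InAut (kimura k a b c d) R S →
    IsDiagonal R → IsDiagonal S →
    ((R ≐ idM k) × (S ≐ idM k)) ⊎ ((R ≐ negM (idM k)) × (S ≐ negM (idM k)))
proposition3p10 k _ _ a b c d _ R S =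
  diagonalAut⇒±id (kimura k a b c d) R S (kimura≢0 k a b c d)
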